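{- For every $n$ and every permutation $\sigma$ of $n$ qubits, the controlled permutation (applying the qubit permutation $\sigma$ to the $n$ qubits if and only if a control qubit is in state $|1\rangle$) can be performed by a quantum circuit of size $O(n)$ and depth $O(\log n)$.
   Context: Circuits are built from gates acting on a constant number of qubits (e.g. controlled-NOT, Toffoli, controlled-SWAP) and may use ancilla qubits initialized to $|0\rangle$ and returned to $|0\rangle$. The size of a circuit is its number of gates and wires; its depth is its number of time steps, where gates acting on disjoint qubits can be applied in the same time step. -}

module Defs where

open import Data.Nat using (ℕ; zero; suc; _+_; _*_; _≤_)
open import Data.Bool using (Bool; true; false; if_then_else_)
open import Data.Fin using (Fin; _≟_)
open import Data.Fin.Properties using (any?)
open import Data.Fin.Permutation using (Permutation′; _⟨$⟩ˡ_)
open import Data.Vec.Functional using (_++_) renaming (_∷_ to _◂_)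
open import Data.List using (List; length; map; foldl)
open import Data.Nat.ListAction using (sum)
open import Data.List.Relation.Unary.AllPairs using (AllPairs)
open import Data.Product using (_,_)
open import Function using (_∘_)
open import Function.Definitions using (Injective)
open import Relation.Binary.PropositionalEquality using (_≡_; _≢_)
open import Relation.Nullary using (yes; no)

-- Classical basis state of m (qu)bits: a bit string indexed by wire.
State : ℕ → Set
State m = Fin m → Bool

-- A reversible gate on at most K of the m wires: it acts on the
-- (distinct) wires `wires 0 … wires (arity-1)` by a bijection `fun`
-- of the basis states of those wires (e.g. NOT, CNOT, Toffoli, CSWAP).
record Gate (K m : ℕ) : Set where
  field
    arity    : ℕ
    arity≤K  : arity ≤ K
    wires    : Fin arity → Fin m
    wiresInj : Injective _≡_ _≡_ wires
    fun      : State arity → State arity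
    funInv   : State arity → State arity
    invˡ     : ∀ v i → funInv (fun v) i ≡ v i
    invʳ     : ∀ v i → fun (funInv v) i ≡ v i
open Gate public

applyGate : ∀ {K m} → Gate K m → State m → State m
applyGate g s w with any? (λ j → wires g j ≟ w)
... | yes (j , _) = fun g (s ∘ wires g) j
... | no _        = s w

DisjointGates : ∀ {K m} → Gate K m → Gate K m → Set
DisjointGates g h = ∀ i j → wires g i ≢ wires h j

-- A time step: gates acting on pairwise disjoint wires.
record Layer (K m : ℕ) : Set where
  field
    gates    : List (Gate K m)
    disjoint : AllPairs DisjointGates gates
open Layer public

applyLayer : ∀ {K m} → Layer K m → State m → State m
applyLayer L s = foldl (λ t g → applyGate g t) s (gates L)

-- A circuit on m wires: a sequence of time steps (applied left to right).
Circuit : ℕ → ℕ → Set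
Circuit K m = List (Layer K m)

run : ∀ {K m} → Circuit K m → State m → State m
run C s = foldl (λ t L → applyLayer L t) s C

depth : ∀ {K m} → Circuit K m → ℕ
depth C = length C

size : ∀ {K m} → Circuit K m → ℕ
size {m = m} C = sum (map (λ L → length (gates L)) C) + m

-- Apply the qubit permutation σ to the data bits: qubit i is moved to
-- position σ i, i.e. output position j holds input bit σ⁻¹ j.
permuteQubits : ∀ {n} → Permutation′ n → State n → State n
permuteQubits σ x j = x (σ ⟨$⟩ˡ j)

-- Wire layout: wire 0 is the control, wires 1..n the data qubits,
-- the remaining a wires are ancillas.
layout : ∀ {n a} → Bool → State n → State (suc n + a)
layout c x = (c ◂ x) ++ (λ _ → false)

-- C performs the controlled permutation of σ using a ancillas
-- (initialized to 0 and returned to 0).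
ImplementsControlledPerm : ∀ {K n a} → Permutation′ n → Circuit K (suc n + a) → Set
ImplementsControlledPerm {n = n} {a = a} σ C =
  ∀ (c : Bool) (x : State n) (w : Fin (suc n + a)) →
    run C (layout {n} {a} c x) w
      ≡ layout {n} {a} c (if c then permuteQubits σ x else x) w

{-# OPTIONS --safe #-}

-- A CNOT copies the control onto an ancilla, and ⌈log₂ n⌉ further layers of CNOTs, each
-- doubling the number of copies, fan it out to N = 2 ^ ⌈log₂ n⌉ ≥ n copies.  Copy i then
-- controls a Fredkin gate that swaps qubit i with scratch qubit σ i, and a second layer of
-- Fredkin gates swaps scratch qubit j back into qubit j: together they apply σ when the
-- control is 1 and nothing when it is 0.  Running the fan-out backwards returns the copies
-- to 0.  This takes 2 ⌈log₂ n⌉ + 4 layers, and since N ≤ 2 n + 1 it uses O(n) gates and wires.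

module Submission where

open import Defs
open import Data.Nat using (ℕ; zero; suc; _+_; _*_; _≤_; _<_; _∸_; _^_; z≤n; s≤s; _<?_; ⌊_/2⌋; ⌈_/2⌉)
open import Data.Nat.Properties
  using ( ≤-refl; ≤-reflexive; ≤-trans; <-≤-trans; <⇒≤; <⇒≱; ≤⇒≯; ≮⇒≥; ≰⇒>; 1+n≰n; n≤1+n; m≤m+n; m≤n+m
        ; +-comm; +-identityʳ; +-cancelʳ-≡; +-mono-≤; +-monoˡ-≤; +-monoʳ-≤; +-monoˡ-<; +-monoʳ-<; *-monoʳ-≤
        ; ∸-monoˡ-<; m+n∸m≡n; m∸n+n≡m; m^n>0; ⌊n/2⌋+⌈n/2⌉≡n; ⌊n/2⌋≤⌈n/2⌉; module ≤-Reasoning)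
open import Data.Nat.Logarithm using (⌈log₂_⌉; ⌈log₂⌉-mono-≤; ⌈log₂2^n⌉≡n)
open import Data.Nat.Logarithm.Core using (⌈log2⌉)
open import Data.Nat.Induction using (<-wellFounded)
open import Induction.WellFounded using (Acc; acc)
open import Data.Nat.Tactic.RingSolver using (solve-∀)
open import Data.Bool using (Bool; true; false; if_then_else_; _xor_)
open import Data.Bool.Properties using (xor-identityʳ; xor-same; not-involutive)
open import Data.Fin using (Fin; zero; suc; toℕ; fromℕ<; inject≤; join; splitAt; _≟_)
open import Data.Fin.Properties
  using (any?; toℕ-injective; toℕ-fromℕ<; toℕ-inject≤; inject≤-injective; toℕ<n; join-splitAt; splitAt-join)
open import Data.Fin.Permutation using (Permutation′; _⟨$⟩ʳ_; _⟨$⟩ˡ_; inverseʳ; inverseˡ; id)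
open import Data.List using (List; []; _∷_; _++_; [_]; tabulate; foldl; length; map)
open import Data.List.Properties using (length-tabulate; length-++; foldl-++; map-++)
open import Data.Nat.ListAction using (sum)
open import Data.Nat.ListAction.Properties using (sum-++)
open import Data.List.Relation.Unary.All as All using (All; []; _∷_)
open import Data.List.Relation.Unary.All.Properties using () renaming (tabulate⁺ to All-tabulate⁺)
open import Data.List.Relation.Unary.AllPairs using (AllPairs; []; _∷_)
open import Data.List.Relation.Unary.AllPairs.Properties
  using () renaming (tabulate⁺ to AllPairs-tabulate⁺)
open import Data.List.Relation.Unary.Any using (here; there)
open import Data.List.Membership.Propositional using (_∈_)
open import Data.List.Membership.Propositional.Properties using (∈-tabulate⁺)
open import Data.Product using (Σ; ∃; _×_; _,_; proj₁; proj₂; curry)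
open import Data.Sum using (_⊎_; inj₁; inj₂; map₂; [_,_]′)
open import Data.Empty using (⊥-elim)
open import Function using (_∘_)
open import Function.Definitions using (Injective)
open import Relation.Binary.PropositionalEquality
  using (_≡_; _≢_; refl; sym; trans; cong; cong₂; subst; subst₂; _≗_; module ≡-Reasoning)
open import Relation.Nullary using (yes; no; does)
open import Relation.Nullary.Decidable using (dec-true; dec-false)
open import Data.Vec.Functional using () renaming (_∷_ to _◂_)

private
  variable
    a K L m : ℕ

Respects : Gate K m → Set
Respects g = ∀ {u v} → u ≗ v → fun g u ≗ fun g v

Fixes : Gate K m → Fin m → Set
Fixes g w = ∀ j → wires g j ≡ w → ∀ u → fun g u j ≡ u j

applyGate-fixed : (g : Gate K m) (s : State m) {w : Fin m} → Fixes g w → applyGate g s w ≡ s w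
applyGate-fixed g s {w} g-fixes-w with any? (λ j → wires g j ≟ w)
... | yes (j , gj≡w) = trans (g-fixes-w j gj≡w (s ∘ wires g)) (cong s gj≡w)
... | no _ = refl

applyGate-wires : (g : Gate K m) (s : State m) (j : Fin (arity g)) →
                  applyGate g s (wires g j) ≡ fun g (s ∘ wires g) j
applyGate-wires g s j with any? (λ j′ → wires g j′ ≟ wires g j)
... | yes (j′ , e) = cong (fun g (s ∘ wires g)) (wiresInj g e)
... | no none = ⊥-elim (none (j , refl))

applyGates : State m → List (Gate K m) → State m
applyGates = foldl (λ t g → applyGate g t)

applyGates-fixed : (gs : List (Gate K m)) (s : State m) {w : Fin m} →
                   All (λ g → Fixes g w) gs → applyGates s gs w ≡ s w
applyGates-fixed []       s []       = refl
applyGates-fixed (g ∷ gs) s (g-fixes ∷ gs-fix) =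
  trans (applyGates-fixed gs (applyGate g s) gs-fix) (applyGate-fixed g s g-fixes)

applyGates-wires : {gs : List (Gate K m)} → AllPairs DisjointGates gs → All Respects gs →
                   {g : Gate K m} → g ∈ gs → (s : State m) (j : Fin (arity g)) →
                   applyGates s gs (wires g j) ≡ fun g (s ∘ wires g) j
applyGates-wires {gs = g ∷ gs} (g#gs ∷ _) _ (here refl) s j =
  trans (applyGates-fixed gs (applyGate g s) (All.map (λ g#h j′ e → ⊥-elim (g#h j j′ (sym e))) g#gs))
        (applyGate-wires g s j)
applyGates-wires {gs = h ∷ _} (h#gs ∷ gs-disjoint) (_ ∷ gs-respect) {g} (there g∈gs) s j =
  trans (applyGates-wires gs-disjoint gs-respect g∈gs (applyGate h s) j)
        (All.lookup gs-respect g∈gs h-misses-g j)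
  where
  h-misses-g : applyGate h s ∘ wires g ≗ s ∘ wires g
  h-misses-g i = applyGate-fixed h s (λ j′ e → ⊥-elim (All.lookup h#gs g∈gs j′ i e))

record ControlledInvolution (a : ℕ) : Set where
  field
    act           : State (suc a) → State (suc a)
    act-cong      : ∀ {u v} → u ≗ v → act u ≗ act v
    involutive    : ∀ u → act (act u) ≗ u
    control-fixed : ∀ u → act u zero ≡ u zero
open ControlledInvolution

gateOn : ControlledInvolution a → suc a ≤ K →
         (W : Fin (suc a) → Fin m) → Injective _≡_ _≡_ W → Gate K m
gateOn f a<K W W-injective = record
  { arity = _ ; arity≤K = a<K ; wires = W ; wiresInj = W-injective
  ; fun = act f ; funInv = act f ; invˡ = involutive f ; invʳ = involutive f }

module _ (f : ControlledInvolution a) (a<K : suc a ≤ K)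
         (W : Fin L × Fin (suc a) → Fin m) (W-injective : Injective _≡_ _≡_ W) where

  private
    block : Fin L → Gate K m
    block i = gateOn f a<K (curry W i) (cong proj₂ ∘ W-injective)

  blockLayer : Layer K m
  blockLayer = record
    { gates    = tabulate block
    ; disjoint = AllPairs-tabulate⁺ (λ i≢i′ j j′ e → i≢i′ (cong proj₁ (W-injective e))) }

  blockLayer-size : length (gates blockLayer) ≡ L
  blockLayer-size = length-tabulate block

  blockLayer-block : (s : State m) (i : Fin L) (j : Fin (suc a)) →
                     applyLayer blockLayer s (W (i , j)) ≡ act f (λ j′ → s (W (i , j′))) j
  blockLayer-block s i j =
    applyGates-wires (disjoint blockLayer) (All-tabulate⁺ (λ _ → act-cong f)) (∈-tabulate⁺ i) s j

  blockLayer-control : (s : State m) {w : Fin m} → (∀ i j → W (i , j) ≡ w → j ≡ zero) →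
                       applyLayer blockLayer s w ≡ s w
  blockLayer-control s controls-only =
    applyGates-fixed (gates blockLayer) s (All-tabulate⁺ λ i j e u →
      subst (λ j → act f u j ≡ u j) (sym (controls-only i j e)) (control-fixed f u))

cnot : ControlledInvolution 1
cnot = record
  { act = act′ ; act-cong = act′-cong ; involutive = act′-involutive ; control-fixed = λ _ → refl }
  where
  act′ : State 2 → State 2
  act′ u zero       = u zero
  act′ u (suc zero) = u zero xor u (suc zero)
  act′-cong : ∀ {u v} → u ≗ v → act′ u ≗ act′ v
  act′-cong u≗v zero       = u≗v zero
  act′-cong u≗v (suc zero) = cong₂ _xor_ (u≗v zero) (u≗v (suc zero))
  act′-involutive : ∀ u → act′ (act′ u) ≗ u
  act′-involutive u zero = refl
  act′-involutive u (suc zero) with u zero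
  ... | false = refl
  ... | true  = not-involutive (u (suc zero))

cswap : ControlledInvolution 2
cswap = record
  { act = act′ ; act-cong = act′-cong ; involutive = act′-involutive ; control-fixed = λ _ → refl }
  where
  act′ : State 3 → State 3
  act′ u zero             = u zero
  act′ u (suc zero)       = if u zero then u (suc (suc zero)) else u (suc zero)
  act′ u (suc (suc zero)) = if u zero then u (suc zero) else u (suc (suc zero))
  act′-cong : ∀ {u v} → u ≗ v → act′ u ≗ act′ v
  act′-cong u≗v zero = u≗v zero
  act′-cong u≗v (suc zero)       rewrite u≗v zero | u≗v (suc zero) | u≗v (suc (suc zero)) = refl
  act′-cong u≗v (suc (suc zero)) rewrite u≗v zero | u≗v (suc zero) | u≗v (suc (suc zero)) = refl
  swap-twice : ∀ c (x y : Bool) → (if c then (if c then x else y) else (if c then y else x)) ≡ x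
  swap-twice false x y = refl
  swap-twice true  x y = refl
  act′-involutive : ∀ u → act′ (act′ u) ≗ u
  act′-involutive u zero             = refl
  act′-involutive u (suc zero)       = swap-twice (u zero) (u (suc zero)) (u (suc (suc zero)))
  act′-involutive u (suc (suc zero)) = swap-twice (u zero) (u (suc (suc zero))) (u (suc zero))

gateCount : Circuit K m → ℕ
gateCount C = sum (map (length ∘ gates) C)

gateCount-++ : (C D : Circuit K m) → gateCount (C ++ D) ≡ gateCount C + gateCount D
gateCount-++ C D = trans (cong sum (map-++ (length ∘ gates) C D)) (sum-++ (map (length ∘ gates) C) _)

run-++ : (C D : Circuit K m) (s : State m) → run (C ++ D) s ≡ run D (run C s)
run-++ C D s = foldl-++ (λ t L → applyLayer L t) s C D

n≤⌈n/2⌉+⌈n/2⌉ : ∀ n → n ≤ ⌈ n /2⌉ + ⌈ n /2⌉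
n≤⌈n/2⌉+⌈n/2⌉ n = begin
  n                   ≡⟨ sym (⌊n/2⌋+⌈n/2⌉≡n n) ⟩
  ⌊ n /2⌋ + ⌈ n /2⌉   ≤⟨ +-monoˡ-≤ ⌈ n /2⌉ (⌊n/2⌋≤⌈n/2⌉ n) ⟩
  ⌈ n /2⌉ + ⌈ n /2⌉   ∎
  where open ≤-Reasoning

n≤2^⌈log₂n⌉ : ∀ n → n ≤ 2 ^ ⌈log₂ n ⌉
n≤2^⌈log₂n⌉ n = n≤2^⌈log2⌉ n (<-wellFounded n)
  where
  -- Induction along the recursion ⌈log2⌉ (2 + n) = 1 + ⌈log2⌉ (1 + ⌈ n /2⌉) defining ⌈log₂_⌉.
  2+[h+h]≡2*[1+h] : ∀ h → 2 + (h + h) ≡ 2 * (1 + h)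
  2+[h+h]≡2*[1+h] = solve-∀
  n≤2^⌈log2⌉ : ∀ n (rec : Acc _<_ n) → n ≤ 2 ^ ⌈log2⌉ n rec
  n≤2^⌈log2⌉ 0             _         = z≤n
  n≤2^⌈log2⌉ 1             _         = ≤-refl
  n≤2^⌈log2⌉ (suc (suc n)) (acc rs) = begin
    2 + n                      ≤⟨ +-monoʳ-≤ 2 (n≤⌈n/2⌉+⌈n/2⌉ n) ⟩
    2 + (⌈ n /2⌉ + ⌈ n /2⌉)    ≡⟨ 2+[h+h]≡2*[1+h] ⌈ n /2⌉ ⟩
    2 * suc ⌈ n /2⌉            ≤⟨ *-monoʳ-≤ 2 (n≤2^⌈log2⌉ (suc ⌈ n /2⌉) _) ⟩
    2 * 2 ^ ⌈log2⌉ (suc ⌈ n /2⌉) _ ∎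
    where open ≤-Reasoning

⌈log₂⌉-least : ∀ {n t} → n ≤ 2 ^ t → ⌈log₂ n ⌉ ≤ t
⌈log₂⌉-least {n} {t} n≤2^t = subst (⌈log₂ n ⌉ ≤_) (⌈log₂2^n⌉≡n t) (⌈log₂⌉-mono-≤ n≤2^t)

2^⌈log₂n⌉≤1+2n : ∀ n → 2 ^ ⌈log₂ n ⌉ ≤ 1 + 2 * n
2^⌈log₂n⌉≤1+2n n with ⌈log₂ n ⌉ in ⌈log₂n⌉≡
... | zero  = s≤s z≤n
... | suc t = ≤-trans (*-monoʳ-≤ 2 (<⇒≤ 2^t<n)) (n≤1+n (2 * n))
  where
  2^t<n : 2 ^ t < n
  2^t<n = ≰⇒> (λ n≤2^t → 1+n≰n (subst (_≤ t) ⌈log₂n⌉≡ (⌈log₂⌉-least n≤2^t)))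

module ControlledPermutation (n k : ℕ) (n≤N : n ≤ 2 ^ k) where

  N : ℕ
  N = 2 ^ k

  width : ℕ
  width = suc n + (N + n)

  -- Wires in the order of `layout`: the control, the n qubits, and then the ancillas,
  -- namely N copies of the control and n scratch qubits.
  Wire : Set
  Wire = Fin (suc n) ⊎ (Fin N ⊎ Fin n)

  pattern control   = inj₁ zero
  pattern qubit i   = inj₁ (suc i)
  pattern copy v    = inj₂ (inj₁ v)
  pattern scratch i = inj₂ (inj₂ i)

  enc : Wire → Fin width
  enc = join (suc n) (N + n) ∘ map₂ (join N n)

  dec : Fin width → Wire
  dec = map₂ (splitAt N) ∘ splitAt (suc n)

  dec-enc : ∀ w → dec (enc w) ≡ w
  dec-enc w = begin
    map₂ (splitAt N) (splitAt (suc n) (join (suc n) (N + n) (map₂ (join N n) w)))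
      ≡⟨ cong (map₂ (splitAt N)) (splitAt-join (suc n) (N + n) (map₂ (join N n) w)) ⟩
    map₂ (splitAt N) (map₂ (join N n) w)
      ≡⟨ split-join w ⟩
    w ∎
    where
    open ≡-Reasoning
    split-join : ∀ w → map₂ (splitAt N) (map₂ (join N n) w) ≡ w
    split-join (inj₁ i) = refl
    split-join (inj₂ u) = cong inj₂ (splitAt-join N n u)

  enc-dec : ∀ i → enc (dec i) ≡ i
  enc-dec i = begin
    join (suc n) (N + n) (map₂ (join N n) (map₂ (splitAt N) (splitAt (suc n) i)))
      ≡⟨ cong (join (suc n) (N + n)) (join-split (splitAt (suc n) i)) ⟩
    join (suc n) (N + n) (splitAt (suc n) i)
      ≡⟨ join-splitAt (suc n) (N + n) i ⟩
    i ∎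
    where
    open ≡-Reasoning
    join-split : ∀ w → map₂ (join N n) (map₂ (splitAt N) w) ≡ w
    join-split (inj₁ i) = refl
    join-split (inj₂ u) = cong inj₂ (join-splitAt N n u)

  enc-injective : Injective _≡_ _≡_ enc
  enc-injective {w} {w′} e = trans (sym (dec-enc w)) (trans (cong dec e) (dec-enc w′))

  copy-injective : ∀ {v v′ : Fin N} → _≡_ {A = Wire} (copy v) (copy v′) → v ≡ v′
  copy-injective refl = refl

  scratch-injective : ∀ {i i′ : Fin n} → _≡_ {A = Wire} (scratch i) (scratch i′) → i ≡ i′
  scratch-injective refl = refl

  _≈_ : State width → (Wire → Bool) → Set
  s ≈ κ = ∀ w → s (enc w) ≡ κ w

  ≈-unique : ∀ {s t κ} → s ≈ κ → t ≈ κ → s ≗ t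
  ≈-unique {s} {t} {κ} s≈κ t≈κ i = begin
    s i             ≡⟨ cong s (sym (enc-dec i)) ⟩
    s (enc (dec i)) ≡⟨ s≈κ (dec i) ⟩
    κ (dec i)       ≡⟨ sym (t≈κ (dec i)) ⟩
    t (enc (dec i)) ≡⟨ cong t (enc-dec i) ⟩
    t i             ∎
    where open ≡-Reasoning

  record _takes_to_ (C : Circuit 3 width) (κ κ′ : Wire → Bool) : Set where
    constructor mkTakes
    field run-≈ : ∀ {s} → s ≈ κ → run C s ≈ κ′
  open _takes_to_

  takes-[] : ∀ {κ} → [] takes κ to κ
  takes-[] = mkTakes (λ s≈κ → s≈κ)

  infixr 4 _⨾_
  _⨾_ : ∀ {C D κ κ′ κ″} → C takes κ to κ′ → D takes κ′ to κ″ → (C ++ D) takes κ to κ″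
  _⨾_ {C} {D} C-takes D-takes = mkTakes λ {s} s≈κ w →
    trans (cong (λ t → t (enc w)) (run-++ C D s)) (run-≈ D-takes (run-≈ C-takes s≈κ) w)

  copies : Bool → ℕ → ℕ → Bool
  copies c L v = if does (v <? L) then c else false

  config : Bool → (Fin n → Bool) → (ℕ → Bool) → (Fin n → Bool) → Wire → Bool
  config c X F Y control     = c
  config c X F Y (qubit i)   = X i
  config c X F Y (copy v)    = F (toℕ v)
  config c X F Y (scratch i) = Y i

  layout≈config : ∀ c x → layout {n} {N + n} c x ≈ config c x (copies c 0) (λ _ → false)
  layout≈config c x w =
    trans (cong [ c ◂ x , (λ _ → false) ]′ (splitAt-join (suc n) (N + n) (map₂ (join N n) w)))
          (on-parts w)
    where
    on-parts : ∀ w → [ c ◂ x , (λ _ → false) ]′ (map₂ (join N n) w)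
                     ≡ config c x (copies c 0) (λ _ → false) w
    on-parts control     = refl
    on-parts (qubit i)   = refl
    on-parts (copy v)    = refl
    on-parts (scratch i) = refl

  copies-< : ∀ {c L v} → v < L → copies c L v ≡ c
  copies-< {c} {L} {v} v<L rewrite dec-true (v <? L) v<L = refl

  copies-≥ : ∀ {c L v} → L ≤ v → copies c L v ≡ false
  copies-≥ {c} {L} {v} L≤v rewrite dec-false (v <? L) (≤⇒≯ L≤v) = refl

  module WireLayer (f : ControlledInvolution a) (a<3 : suc a ≤ 3)
                   (V : Fin L × Fin (suc a) → Wire) (V-injective : Injective _≡_ _≡_ V) where

    private
      enc∘V-injective : Injective _≡_ _≡_ (enc ∘ V)
      enc∘V-injective = V-injective ∘ enc-injective

    layer : Layer 3 width
    layer = blockLayer f a<3 (enc ∘ V) enc∘V-injective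

    layer-size : length (gates layer) ≡ L
    layer-size = blockLayer-size f a<3 (enc ∘ V) enc∘V-injective

    data Update (κ κ′ : Wire → Bool) (w : Wire) : Set where
      acted : ∀ i j → V (i , j) ≡ w → κ′ w ≡ act f (λ j′ → κ (V (i , j′))) j → Update κ κ′ w
      kept  : (∀ i j → V (i , j) ≡ w → j ≡ zero) → κ′ w ≡ κ w → Update κ κ′ w

    layer-takes : ∀ {κ κ′} → (∀ w → Update κ κ′ w) → [ layer ] takes κ to κ′
    layer-takes {κ} {κ′} update = mkTakes λ {s} s≈κ w → on-wire s s≈κ w (update w)
      where
      on-wire : ∀ s → s ≈ κ → ∀ w → Update κ κ′ w → applyLayer layer s (enc w) ≡ κ′ w
      on-wire s s≈κ w (acted i j refl κ′w≡) =
        trans (blockLayer-block f a<3 (enc ∘ V) enc∘V-injective s i j)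
              (trans (act-cong f (λ j′ → s≈κ (V (i , j′))) j) (sym κ′w≡))
      on-wire s s≈κ w (kept controls-only κ′w≡) =
        trans (blockLayer-control f a<3 (enc ∘ V) enc∘V-injective s
                                  (λ i j e → controls-only i j (enc-injective e)))
              (trans (s≈κ w) (sym κ′w≡))

  first : Fin N
  first = fromℕ< (m^n>0 2 k)

  copyControlWiring : Fin 1 × Fin 2 → Wire
  copyControlWiring (_ , zero)     = control
  copyControlWiring (_ , suc zero) = copy first

  copyControlWiring-injective : Injective _≡_ _≡_ copyControlWiring
  copyControlWiring-injective {zero , zero}     {zero , zero}     _ = refl
  copyControlWiring-injective {zero , suc zero} {zero , suc zero} _ = refl
  copyControlWiring-injective {zero , zero}     {zero , suc zero} ()
  copyControlWiring-injective {zero , suc zero} {zero , zero}     ()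

  module CopyControl = WireLayer cnot (s≤s (s≤s z≤n)) copyControlWiring copyControlWiring-injective

  copyControl : Layer 3 width
  copyControl = CopyControl.layer

  copyControl-step : ∀ {c X F F′ Y} → F′ 0 ≡ c xor F 0 → (∀ v → F′ (suc v) ≡ F (suc v)) →
                     [ copyControl ] takes config c X F Y to config c X F′ Y
  copyControl-step {c} {X} {F} {F′} {Y} at-first elsewhere = CopyControl.layer-takes update
    where
    open CopyControl using (acted; kept)
    update : ∀ w → CopyControl.Update (config c X F Y) (config c X F′ Y) w
    update control     = kept (λ { _ zero _ → refl ; _ (suc zero) () }) refl
    update (qubit i)   = kept (λ { _ zero () ; _ (suc zero) () }) refl
    update (scratch i) = kept (λ { _ zero () ; _ (suc zero) () }) refl
    update (copy v) with toℕ v in toℕv≡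
    ... | zero  = acted zero (suc zero) (cong copy first≡v) (begin
      F′ (toℕ v)          ≡⟨ cong F′ toℕv≡ ⟩
      F′ 0                ≡⟨ at-first ⟩
      c xor F 0           ≡⟨ cong (λ u → c xor F u) (sym (toℕ-fromℕ< _)) ⟩
      c xor F (toℕ first) ∎)
      where
      open ≡-Reasoning
      first≡v : first ≡ v
      first≡v = toℕ-injective (trans (toℕ-fromℕ< _) (sym toℕv≡))
    ... | suc u = kept untouched (trans (cong F′ toℕv≡) (trans (elsewhere u) (cong F (sym toℕv≡))))
      where
      untouched : ∀ i j → copyControlWiring (i , j) ≡ copy v → j ≡ zero
      untouched _ zero       ()
      untouched _ (suc zero) e
        with () ← trans (sym (toℕ-fromℕ< _)) (trans (cong toℕ (copy-injective e)) toℕv≡)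

  copyControl-sets : ∀ {c X Y} →
    [ copyControl ] takes config c X (copies c 0) Y to config c X (copies c 1) Y
  copyControl-sets {c} = copyControl-step (sym (xor-identityʳ c)) (λ _ → refl)

  copyControl-resets : ∀ {c X Y} →
    [ copyControl ] takes config c X (copies c 1) Y to config c X (copies c 0) Y
  copyControl-resets {c} = copyControl-step (sym (xor-same c)) (λ _ → refl)

  module Fan (L : ℕ) (2L≤N : 2 * L ≤ N) where

    2L≡L+L : 2 * L ≡ L + L
    2L≡L+L = cong (L +_) (+-identityʳ L)

    L+L≤N : L + L ≤ N
    L+L≤N = subst (_≤ N) 2L≡L+L 2L≤N

    source<N : (i : Fin L) → toℕ i < N
    source<N i = ≤-trans (toℕ<n i) (≤-trans (m≤m+n L L) L+L≤N)

    target<N : (i : Fin L) → toℕ i + L < N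
    target<N i = ≤-trans (+-monoˡ-< L (toℕ<n i)) L+L≤N

    source target : Fin L → Fin N
    source i = fromℕ< (source<N i)
    target i = fromℕ< (target<N i)

    fanWiring : Fin L × Fin 2 → Wire
    fanWiring (i , zero)     = copy (source i)
    fanWiring (i , suc zero) = copy (target i)

    toℕ-source : ∀ i → toℕ (source i) ≡ toℕ i
    toℕ-source i = toℕ-fromℕ< (source<N i)

    toℕ-target : ∀ i → toℕ (target i) ≡ toℕ i + L
    toℕ-target i = toℕ-fromℕ< (target<N i)

    source≢target : (i i′ : Fin L) → toℕ i ≢ toℕ i′ + L
    source≢target i i′ e = <⇒≱ (toℕ<n i) (≤-trans (m≤n+m L (toℕ i′)) (≤-reflexive (sym e)))

    copy-target : ∀ i {v} → copy (target i) ≡ copy v → toℕ v ≡ toℕ i + L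
    copy-target i e = trans (cong toℕ (sym (copy-injective e))) (toℕ-target i)

    fanWiring-injective : Injective _≡_ _≡_ fanWiring
    fanWiring-injective {i , zero} {i′ , zero} e =
      cong (_, zero) (toℕ-injective (begin
        toℕ i            ≡⟨ sym (toℕ-source i) ⟩
        toℕ (source i)   ≡⟨ cong toℕ (copy-injective e) ⟩
        toℕ (source i′)  ≡⟨ toℕ-source i′ ⟩
        toℕ i′           ∎))
      where open ≡-Reasoning
    fanWiring-injective {i , zero} {i′ , suc zero} e =
      ⊥-elim (source≢target i i′ (trans (sym (toℕ-source i)) (copy-target i′ (sym e))))
    fanWiring-injective {i , suc zero} {i′ , zero} e =
      ⊥-elim (source≢target i′ i (trans (sym (toℕ-source i′)) (copy-target i e)))
    fanWiring-injective {i , suc zero} {i′ , suc zero} e =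
      cong (_, suc zero) (toℕ-injective (+-cancelʳ-≡ L _ _ (begin
        toℕ i + L        ≡⟨ sym (toℕ-target i) ⟩
        toℕ (target i)   ≡⟨ cong toℕ (copy-injective e) ⟩
        toℕ (target i′)  ≡⟨ toℕ-target i′ ⟩
        toℕ i′ + L       ∎)))
      where open ≡-Reasoning

    module FanLayer = WireLayer cnot (s≤s (s≤s z≤n)) fanWiring fanWiring-injective

    fanLayer : Layer 3 width
    fanLayer = FanLayer.layer

    offset<L : ∀ {v} → L ≤ v → v < 2 * L → v ∸ L < L
    offset<L {v} L≤v v<2L =
      subst (v ∸ L <_) (trans (m+n∸m≡n L (L + 0)) (+-identityʳ L)) (∸-monoˡ-< v<2L L≤v)

    fan-step : ∀ {c X F F′ Y} →
               (∀ {v} → v < L → F′ v ≡ F v) →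
               (∀ {v} → L ≤ v → v < 2 * L → F′ v ≡ F (v ∸ L) xor F v) →
               (∀ {v} → 2 * L ≤ v → F′ v ≡ F v) →
               [ fanLayer ] takes config c X F Y to config c X F′ Y
    fan-step {c} {X} {F} {F′} {Y} below inside above = FanLayer.layer-takes update
      where
      open FanLayer using (acted; kept)
      update : ∀ w → FanLayer.Update (config c X F Y) (config c X F′ Y) w
      update control     = kept (λ { _ zero () ; _ (suc zero) () }) refl
      update (qubit i)   = kept (λ { _ zero () ; _ (suc zero) () }) refl
      update (scratch i) = kept (λ { _ zero () ; _ (suc zero) () }) refl
      update (copy v) with toℕ v <? L
      ... | yes v<L = kept only-source (below v<L)
        where
        only-source : ∀ i j → fanWiring (i , j) ≡ copy v → j ≡ zero
        only-source i zero       _ = refl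
        only-source i (suc zero) e =
          ⊥-elim (<⇒≱ v<L (subst (L ≤_) (sym (copy-target i e)) (m≤n+m L (toℕ i))))
      ... | no v≮L with toℕ v <? 2 * L
      ...   | yes v<2L = acted i (suc zero) (cong copy target≡v) (begin
        F′ (toℕ v)                                ≡⟨ inside (≮⇒≥ v≮L) v<2L ⟩
        F (toℕ v ∸ L) xor F (toℕ v)               ≡⟨ cong₂ (λ a b → F a xor F b) toℕ-source≡ (cong toℕ target≡v) ⟨
        F (toℕ (source i)) xor F (toℕ (target i)) ∎)
        where
        open ≡-Reasoning
        i : Fin L
        i = fromℕ< (offset<L (≮⇒≥ v≮L) v<2L)
        toℕi≡ : toℕ i ≡ toℕ v ∸ L
        toℕi≡ = toℕ-fromℕ< (offset<L (≮⇒≥ v≮L) v<2L)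
        toℕ-source≡ : toℕ (source i) ≡ toℕ v ∸ L
        toℕ-source≡ = trans (toℕ-source i) toℕi≡
        target≡v : target i ≡ v
        target≡v = toℕ-injective (begin
          toℕ (target i)  ≡⟨ toℕ-target i ⟩
          toℕ i + L       ≡⟨ cong (_+ L) toℕi≡ ⟩
          toℕ v ∸ L + L   ≡⟨ m∸n+n≡m (≮⇒≥ v≮L) ⟩
          toℕ v           ∎)
      ...   | no v≮2L = kept untouched (above (≮⇒≥ v≮2L))
        where
        untouched : ∀ i j → fanWiring (i , j) ≡ copy v → j ≡ zero
        untouched i zero       _ = refl
        untouched i (suc zero) e =
          ⊥-elim (v≮2L (subst₂ _<_ (sym (copy-target i e)) (sym 2L≡L+L) (+-monoˡ-< L (toℕ<n i))))

    L≤2L : L ≤ 2 * L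
    L≤2L = m≤m+n L (L + 0)

    fan-doubles : ∀ {c X Y} →
      [ fanLayer ] takes config c X (copies c L) Y to config c X (copies c (2 * L)) Y
    fan-doubles {c} = fan-step
      (λ v<L → trans (copies-< (<-≤-trans v<L L≤2L)) (sym (copies-< v<L)))
      (λ L≤v v<2L → trans (copies-< v<2L)
        (sym (trans (cong₂ _xor_ (copies-< (offset<L L≤v v<2L)) (copies-≥ L≤v)) (xor-identityʳ c))))
      (λ 2L≤v → trans (copies-≥ 2L≤v) (sym (copies-≥ (≤-trans L≤2L 2L≤v))))

    fan-halves : ∀ {c X Y} →
      [ fanLayer ] takes config c X (copies c (2 * L)) Y to config c X (copies c L) Y
    fan-halves {c} = fan-step
      (λ v<L → trans (copies-< v<L) (sym (copies-< (<-≤-trans v<L L≤2L))))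
      (λ L≤v v<2L → trans (copies-≥ L≤v)
        (sym (trans (cong₂ _xor_ (copies-< (<-≤-trans (offset<L L≤v v<2L) L≤2L)) (copies-< v<2L)) (xor-same c))))
      (λ 2L≤v → trans (copies-≥ (≤-trans L≤2L 2L≤v)) (sym (copies-≥ 2L≤v)))

  swapWiring : Permutation′ n → Fin n × Fin 3 → Wire
  swapWiring π (i , zero)             = copy (inject≤ i n≤N)
  swapWiring π (i , suc zero)         = qubit i
  swapWiring π (i , suc (suc zero))   = scratch (π ⟨$⟩ʳ i)

  swapWiring-injective : ∀ π → Injective _≡_ _≡_ (swapWiring π)
  swapWiring-injective π {i , zero} {i′ , zero} e =
    cong (_, zero) (inject≤-injective n≤N n≤N i i′ (copy-injective e))
  swapWiring-injective π {i , suc zero} {.i , suc zero} refl = refl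
  swapWiring-injective π {i , suc (suc zero)} {i′ , suc (suc zero)} e =
    cong (_, suc (suc zero)) (begin
      i                        ≡⟨ inverseˡ π ⟨
      π ⟨$⟩ˡ (π ⟨$⟩ʳ i)        ≡⟨ cong (π ⟨$⟩ˡ_) (scratch-injective e) ⟩
      π ⟨$⟩ˡ (π ⟨$⟩ʳ i′)       ≡⟨ inverseˡ π ⟩
      i′                       ∎)
    where open ≡-Reasoning
  swapWiring-injective π {_ , zero}           {_ , suc zero}       ()
  swapWiring-injective π {_ , zero}           {_ , suc (suc zero)} ()
  swapWiring-injective π {_ , suc zero}       {_ , zero}           ()
  swapWiring-injective π {_ , suc zero}       {_ , suc (suc zero)} ()
  swapWiring-injective π {_ , suc (suc zero)} {_ , zero}           ()
  swapWiring-injective π {_ , suc (suc zero)} {_ , suc zero}       ()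

  module SwapLayer (π : Permutation′ n) = WireLayer cswap ≤-refl (swapWiring π) (swapWiring-injective π)

  swapLayer : Permutation′ n → Layer 3 width
  swapLayer π = SwapLayer.layer π

  swapLayer-takes : ∀ π {c X Y} →
    [ swapLayer π ] takes config c X (copies c N) Y
                       to config c (λ i → if c then Y (π ⟨$⟩ʳ i) else X i) (copies c N)
                                   (λ j → if c then X (π ⟨$⟩ˡ j) else Y j)
  swapLayer-takes π {c} {X} {Y} = SwapLayer.layer-takes π update
    where
    open SwapLayer π using (Update; acted; kept)
    copy-holds-c : ∀ i → copies c N (toℕ (inject≤ i n≤N)) ≡ c
    copy-holds-c i = copies-< (subst (_< N) (sym (toℕ-inject≤ i n≤N)) (<-≤-trans (toℕ<n i) n≤N))
    update : ∀ w → Update _ _ w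
    update control     = kept (λ { _ zero () ; _ (suc zero) () ; _ (suc (suc zero)) () }) refl
    update (copy v)    = kept (λ { _ zero _ → refl ; _ (suc zero) () ; _ (suc (suc zero)) () }) refl
    update (qubit i)   = acted i (suc zero) refl
      (cong (λ b → if b then Y (π ⟨$⟩ʳ i) else X i) (sym (copy-holds-c i)))
    update (scratch j) = acted (π ⟨$⟩ˡ j) (suc (suc zero)) (cong scratch (inverseʳ π))
      (cong₂ (λ b y → if b then X (π ⟨$⟩ˡ j) else y) (sym (copy-holds-c (π ⟨$⟩ˡ j))) (cong Y (sym (inverseʳ π))))

  2^t≤N : ∀ t → 2 ^ suc t ≤ N → 2 ^ t ≤ N
  2^t≤N t = ≤-trans (m≤m+n (2 ^ t) _)

  fanOut : (t : ℕ) → 2 ^ t ≤ N → Circuit 3 width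
  fanOut zero    _ = []
  fanOut (suc t) p = fanOut t (2^t≤N t p) ++ [ Fan.fanLayer (2 ^ t) p ]

  fanIn : (t : ℕ) → 2 ^ t ≤ N → Circuit 3 width
  fanIn zero    _ = []
  fanIn (suc t) p = [ Fan.fanLayer (2 ^ t) p ] ++ fanIn t (2^t≤N t p)

  fanOut-spreads : ∀ t p {c X Y} →
    fanOut t p takes config c X (copies c 1) Y to config c X (copies c (2 ^ t)) Y
  fanOut-spreads zero    p = takes-[]
  fanOut-spreads (suc t) p = fanOut-spreads t (2^t≤N t p) ⨾ Fan.fan-doubles (2 ^ t) p

  fanIn-gathers : ∀ t p {c X Y} →
    fanIn t p takes config c X (copies c (2 ^ t)) Y to config c X (copies c 1) Y
  fanIn-gathers zero    p = takes-[]
  fanIn-gathers (suc t) p = Fan.fan-halves (2 ^ t) p ⨾ fanIn-gathers t (2^t≤N t p)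

  fanOut-gateCount : ∀ t p → gateCount (fanOut t p) < 2 ^ t
  fanOut-gateCount zero    p = s≤s z≤n
  fanOut-gateCount (suc t) p = begin-strict
    gateCount (fanOut t (2^t≤N t p) ++ [ fan ])  ≡⟨ gateCount-++ (fanOut t (2^t≤N t p)) [ fan ] ⟩
    out + (length (gates fan) + 0)               ≡⟨ cong (λ g → out + (g + 0)) (Fan.FanLayer.layer-size (2 ^ t) p) ⟩
    out + (2 ^ t + 0)                            <⟨ +-monoˡ-< (2 ^ t + 0) (fanOut-gateCount t (2^t≤N t p)) ⟩
    2 ^ suc t                                    ∎
    where
    open ≤-Reasoning
    fan : Layer 3 width
    fan = Fan.fanLayer (2 ^ t) p
    out : ℕ
    out = gateCount (fanOut t (2^t≤N t p))

  fanIn-gateCount : ∀ t p → gateCount (fanIn t p) < 2 ^ t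
  fanIn-gateCount zero    p = s≤s z≤n
  fanIn-gateCount (suc t) p = begin-strict
    length (gates fan) + in′  ≡⟨ cong (_+ in′) (Fan.FanLayer.layer-size (2 ^ t) p) ⟩
    2 ^ t + in′               <⟨ +-monoʳ-< (2 ^ t) (<-≤-trans (fanIn-gateCount t (2^t≤N t p)) (m≤m+n (2 ^ t) 0)) ⟩
    2 ^ suc t                 ∎
    where
    open ≤-Reasoning
    fan : Layer 3 width
    fan = Fan.fanLayer (2 ^ t) p
    in′ : ℕ
    in′ = gateCount (fanIn t (2^t≤N t p))

  fanOut-depth : ∀ t p → depth (fanOut t p) ≡ t
  fanOut-depth zero    p = refl
  fanOut-depth (suc t) p = begin
    length (fanOut t (2^t≤N t p) ++ [ Fan.fanLayer (2 ^ t) p ]) ≡⟨ length-++ (fanOut t (2^t≤N t p)) ⟩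
    length (fanOut t (2^t≤N t p)) + 1                           ≡⟨ cong (_+ 1) (fanOut-depth t (2^t≤N t p)) ⟩
    t + 1                                                       ≡⟨ +-comm t 1 ⟩
    suc t                                                       ∎
    where open ≡-Reasoning

  fanIn-depth : ∀ t p → depth (fanIn t p) ≡ t
  fanIn-depth zero    p = refl
  fanIn-depth (suc t) p = cong suc (fanIn-depth t (2^t≤N t p))

  controlledPermutation : Permutation′ n → Circuit 3 width
  controlledPermutation σ =
    [ copyControl ] ++ fanOut k ≤-refl ++ ([ swapLayer σ ] ++ [ swapLayer id ])
                    ++ fanIn k ≤-refl ++ [ copyControl ]

  controlledPermutation-takes : ∀ σ c x →
    controlledPermutation σ takes config c x (copies c 0) (λ _ → false)
                              to config c (if c then permuteQubits σ x else x) (copies c 0) (λ _ → false)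
  controlledPermutation-takes σ c x =
    copyControl-sets ⨾ fanOut-spreads k ≤-refl ⨾ permute c ⨾ fanIn-gathers k ≤-refl
                     ⨾ copyControl-resets
    where
    permute : ∀ c → ([ swapLayer σ ] ++ [ swapLayer id ])
                      takes config c x (copies c N) (λ _ → false)
                      to config c (if c then permuteQubits σ x else x) (copies c N) (λ _ → false)
    permute false = swapLayer-takes σ ⨾ swapLayer-takes id
    permute true  = swapLayer-takes σ ⨾ swapLayer-takes id

  controlledPermutation-implements : ∀ σ → ImplementsControlledPerm σ (controlledPermutation σ)
  controlledPermutation-implements σ c x =
    ≈-unique (run-≈ (controlledPermutation-takes σ c x) (layout≈config c x)) (layout≈config c _)

  controlledPermutation-size : ∀ σ → size (controlledPermutation σ) ≤ 3 * N + 4 * n + 1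
  controlledPermutation-size σ = begin
    1 + gateCount (fanOut k ≤-refl ++ rest) + width
      ≡⟨ cong (λ g → 1 + g + width) (gateCount-++ (fanOut k ≤-refl) rest) ⟩
    1 + (out + gateCount rest) + width
      ≡⟨ cong (λ g → 1 + (out + g) + width) rest-gateCount ⟩
    1 + (out + (n + (n + (in′ + 1)))) + width
      ≡⟨ rearrange out in′ n N ⟩
    (1 + out) + (in′ + 1) + (4 * n + N + 1)
      ≤⟨ +-monoˡ-≤ (4 * n + N + 1) (+-mono-≤ (fanOut-gateCount k ≤-refl) in′+1≤N) ⟩
    N + N + (4 * n + N + 1)
      ≡⟨ tidy n N ⟩
    3 * N + 4 * n + 1 ∎
    where
    open ≤-Reasoning
    rest : Circuit 3 width
    rest = swapLayer σ ∷ swapLayer id ∷ fanIn k ≤-refl ++ [ copyControl ]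
    out in′ : ℕ
    out = gateCount (fanOut k ≤-refl)
    in′ = gateCount (fanIn k ≤-refl)
    rest-gateCount : gateCount rest ≡ n + (n + (in′ + 1))
    rest-gateCount = cong₂ _+_ (SwapLayer.layer-size σ)
                               (cong₂ _+_ (SwapLayer.layer-size id) (gateCount-++ (fanIn k ≤-refl) _))
    in′+1≤N : in′ + 1 ≤ N
    in′+1≤N = subst (_≤ N) (+-comm 1 in′) (fanIn-gateCount k ≤-refl)
    rearrange : ∀ a b n N → 1 + (a + (n + (n + (b + 1)))) + (suc n + (N + n))
                            ≡ (1 + a) + (b + 1) + (4 * n + N + 1)
    rearrange = solve-∀
    tidy : ∀ n N → N + N + (4 * n + N + 1) ≡ 3 * N + 4 * n + 1
    tidy = solve-∀

  controlledPermutation-depth : ∀ σ → depth (controlledPermutation σ) ≡ 2 * k + 4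
  controlledPermutation-depth σ = begin
    1 + length (fanOut k ≤-refl ++ rest)
      ≡⟨ cong suc (length-++ (fanOut k ≤-refl)) ⟩
    1 + (length (fanOut k ≤-refl) + (2 + length (fanIn k ≤-refl ++ [ copyControl ])))
      ≡⟨ cong₂ (λ a b → 1 + (a + (2 + b))) (fanOut-depth k ≤-refl) fanIn-depth′ ⟩
    1 + (k + (2 + (k + 1)))
      ≡⟨ rearrange k ⟩
    2 * k + 4 ∎
    where
    open ≡-Reasoning
    rest : Circuit 3 width
    rest = swapLayer σ ∷ swapLayer id ∷ fanIn k ≤-refl ++ [ copyControl ]
    fanIn-depth′ : length (fanIn k ≤-refl ++ [ copyControl ]) ≡ k + 1
    fanIn-depth′ = trans (length-++ (fanIn k ≤-refl)) (cong (_+ 1) (fanIn-depth k ≤-refl))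
    rearrange : ∀ k → 1 + (k + (2 + (k + 1))) ≡ 2 * k + 4
    rearrange = solve-∀

size-arithmetic : ∀ n N → N ≤ 1 + 2 * n → 3 * N + 4 * n + 1 ≤ 10 * (n + 1)
size-arithmetic n N N≤1+2n = begin
  3 * N + 4 * n + 1             ≤⟨ +-monoˡ-≤ 1 (+-monoˡ-≤ (4 * n) (*-monoʳ-≤ 3 N≤1+2n)) ⟩
  3 * (1 + 2 * n) + 4 * n + 1   ≤⟨ m≤m+n _ 6 ⟩
  3 * (1 + 2 * n) + 4 * n + 1 + 6 ≡⟨ rearrange n ⟩
  10 * (n + 1)                  ∎
  where
  open ≤-Reasoning
  rearrange : ∀ n → 3 * (1 + 2 * n) + 4 * n + 1 + 6 ≡ 10 * (n + 1)
  rearrange = solve-∀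

depth-arithmetic : ∀ k → 2 * k + 4 ≤ 4 * (k + 1)
depth-arithmetic k = ≤-trans (m≤m+n (2 * k + 4) (2 * k)) (≤-reflexive (rearrange k))
  where
  rearrange : ∀ k → 2 * k + 4 + 2 * k ≡ 4 * (k + 1)
  rearrange = solve-∀

mainTheorem4 : ∃ λ (K : ℕ) → ∃ λ (cs : ℕ) → ∃ λ (cd : ℕ) →
    ∀ (n : ℕ) (σ : Permutation′ n) →
      ∃ λ (a : ℕ) → Σ (Circuit K (suc n + a)) λ C →
        ImplementsControlledPerm σ C
          × size C ≤ cs * (n + 1)
          × depth C ≤ cd * (⌈log₂ n ⌉ + 1)
mainTheorem4 = 3 , 10 , 4 , λ n σ →
  let open ControlledPermutation n ⌈log₂ n ⌉ (n≤2^⌈log₂n⌉ n) in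
  N + n , controlledPermutation σ , controlledPermutation-implements σ ,
  ≤-trans (controlledPermutation-size σ) (size-arithmetic n N (2^⌈log₂n⌉≤1+2n n)) ,
  ≤-trans (≤-reflexive (controlledPermutation-depth σ)) (depth-arithmetic ⌈log₂ n ⌉)
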